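{- Let $n\geq 3$ and let $\pi=\pi_1\cdots\pi_n\in\mathcal{S}_n$ avoid both $213$ and $312$. If for some $i$ with $2\le i\le n-1$ the entries $\pi^2(i-1)\pi^2(i)\pi^2(i+1)$ form an occurrence of the consecutive pattern $\overline{213}$ in $\pi^2$ (i.e. $\pi^2(i)<\pi^2(i-1)<\pi^2(i+1)$), then $\pi_i=n$.
   Context: $\mathcal{S}_n$ is the set of permutations of $[n]$, written as words with $\pi_i=\pi(i)$; $\pi^2=\pi\circ\pi$. A permutation avoids a pattern $\sigma\in\mathcal{S}_k$ if no (not necessarily consecutive) subsequence of length $k$ is order isomorphic to $\sigma$. -}

module Defs where

open import Data.Nat using (ℕ; _<_)
open import Data.Fin using (Fin; toℕ)
open import Data.Fin.Permutation using (Permutation′; _⟨$⟩ʳ_)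
open import Data.Product using (_×_)
open import Relation.Nullary using (¬_)

-- Permutations of [n] are represented as bijections Fin n ↔ Fin n
-- (0-based: position i+1 / value v+1 of the paper correspond to Fin elements i / v).

val : ∀ {n} → Permutation′ n → Fin n → ℕ
val π x = toℕ (π ⟨$⟩ʳ x)

Avoids213 : ∀ {n} → Permutation′ n → Set
Avoids213 {n} π = ∀ (i j k : Fin n) → toℕ i < toℕ j → toℕ j < toℕ k →
  ¬ (val π j < val π i × val π i < val π k)

Avoids312 : ∀ {n} → Permutation′ n → Set
Avoids312 {n} π = ∀ (i j k : Fin n) → toℕ i < toℕ j → toℕ j < toℕ k →
  ¬ (val π j < val π k × val π k < val π i)

sq : ∀ {n} → Permutation′ n → Fin n → Fin n
sq π x = π ⟨$⟩ʳ (π ⟨$⟩ʳ x)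

-- Avoiding both 213 and 312 means π has no valley, i.e. no entry smaller than
-- an entry on each side of it. An occurrence of the consecutive pattern 213
-- in π² at i−1, i, i+1 forces π(i−1) < π(i) > π(i+1): each of the three other
-- shapes of π on these positions yields a valley in π, or a 213 resp. 312 in
-- π at the positions π(i−1), π(i), π(i+1). Without valleys, a local peak is a
-- global maximum, so π(i) = n.
module Submission where

open import Defs
open import Data.Nat using (ℕ; suc; _<_; _≤_; _+_; _∸_)
open import Data.Nat.Properties
  using (+-comm; ≤-refl; <-cmp; <-trans; <-irrefl; <⇒≤; ≤-pred; ≤-reflexive; ≤-antisym; ≮⇒≥; m≤n⇒m<n∨m≡n)
open import Data.Fin using (Fin; toℕ; fromℕ)
open import Data.Fin.Properties using (toℕ-injective; toℕ<n; toℕ-fromℕ)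
open import Data.Fin.Permutation using (Permutation′; _⟨$⟩ʳ_; _⟨$⟩ˡ_; inverseˡ; inverseʳ)
open import Data.Product using (_×_; _,_)
open import Data.Sum using (inj₁; inj₂)
open import Data.Empty using (⊥-elim)
open import Relation.Nullary using (¬_)
open import Relation.Binary.PropositionalEquality using (_≡_; _≢_; sym; trans; cong; subst; module ≡-Reasoning)
open import Relation.Binary.Definitions using (tri<; tri≈; tri>)

NoValley : ∀ {n} → Permutation′ n → Set
NoValley {n} π = ∀ (i j k : Fin n) → toℕ i < toℕ j → toℕ j < toℕ k →
  ¬ (val π j < val π i × val π j < val π k)

module _ {n : ℕ} (π : Permutation′ n) where

  val-injective : ∀ {x y} → val π x ≡ val π y → x ≡ y
  val-injective {x} {y} eq = begin
    x                              ≡⟨ sym (inverseˡ π) ⟩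
    π ⟨$⟩ˡ (π ⟨$⟩ʳ x)              ≡⟨ cong (π ⟨$⟩ˡ_) (toℕ-injective eq) ⟩
    π ⟨$⟩ˡ (π ⟨$⟩ʳ y)              ≡⟨ inverseˡ π ⟩
    y                              ∎
    where open ≡-Reasoning

  <⇒val≢ : ∀ {x y} → toℕ x < toℕ y → val π x ≢ val π y
  <⇒val≢ x<y eq = <-irrefl (cong toℕ (val-injective eq)) x<y

  avoids213∧312⇒noValley : Avoids213 π → Avoids312 π → NoValley π
  avoids213∧312⇒noValley h213 h312 i j k i<j j<k (j<i , j<k′)
    with <-cmp (val π i) (val π k)
  ... | tri< i<k _ _ = h213 i j k i<j j<k (j<i , i<k)
  ... | tri≈ _ i≡k _ = <⇒val≢ (<-trans i<j j<k) i≡k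
  ... | tri> _ _ k<i = h312 i j k i<j j<k (j<k′ , k<i)

  square213⇒peak : Avoids213 π → Avoids312 π → ∀ {a i c} →
    toℕ a < toℕ i → toℕ i < toℕ c →
    toℕ (sq π i) < toℕ (sq π a) → toℕ (sq π a) < toℕ (sq π c) →
    val π a < val π i × val π c < val π i
  square213⇒peak h213 h312 {a} {i} {c} a<i i<c i<a² a<c²
    with <-cmp (val π a) (val π i) | <-cmp (val π i) (val π c)
  ... | tri≈ _ eq _ | _ = ⊥-elim (<⇒val≢ a<i eq)
  ... | _ | tri≈ _ eq _ = ⊥-elim (<⇒val≢ i<c eq)
  ... | tri< πa<πi _ _ | tri< πi<πc _ _ =
    ⊥-elim (h213 (π ⟨$⟩ʳ a) (π ⟨$⟩ʳ i) (π ⟨$⟩ʳ c) πa<πi πi<πc (i<a² , a<c²))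
  ... | tri> _ _ πi<πa | tri> _ _ πc<πi =
    ⊥-elim (h312 (π ⟨$⟩ʳ c) (π ⟨$⟩ʳ i) (π ⟨$⟩ʳ a) πc<πi πi<πa (i<a² , a<c²))
  ... | tri> _ _ πi<πa | tri< πi<πc _ _ =
    ⊥-elim (avoids213∧312⇒noValley h213 h312 a i c a<i i<c (πi<πa , πi<πc))
  ... | tri< πa<πi _ _ | tri> _ _ πc<πi = πa<πi , πc<πi

  module _ (noValley : NoValley π) {i : Fin n} where

    left-of-peak : ∀ {a} → suc (toℕ a) ≡ toℕ i → val π a < val π i →
                   ∀ q → toℕ q < toℕ i → val π q ≤ val π i
    left-of-peak {a} a⋖i πa<πi q q<i
      with m≤n⇒m<n∨m≡n (≤-pred (subst (suc (toℕ q) ≤_) (sym a⋖i) q<i))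
    ... | inj₁ q<a = ≮⇒≥ λ πi<πq →
      noValley q a i q<a (≤-reflexive a⋖i) (<-trans πa<πi πi<πq , πa<πi)
    ... | inj₂ q≡a rewrite toℕ-injective q≡a = <⇒≤ πa<πi

    right-of-peak : ∀ {c} → suc (toℕ i) ≡ toℕ c → val π c < val π i →
                    ∀ q → toℕ i < toℕ q → val π q ≤ val π i
    right-of-peak {c} i⋖c πc<πi q i<q
      with m≤n⇒m<n∨m≡n (subst (_≤ toℕ q) i⋖c i<q)
    ... | inj₁ c<q = ≮⇒≥ λ πi<πq →
      noValley i c q (≤-reflexive i⋖c) c<q (πc<πi , <-trans πc<πi πi<πq)
    ... | inj₂ c≡q rewrite sym (toℕ-injective c≡q) = <⇒≤ πc<πi

    peak⇒max : ∀ {a c} → suc (toℕ a) ≡ toℕ i → suc (toℕ i) ≡ toℕ c →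
               val π a < val π i → val π c < val π i → ∀ q → val π q ≤ val π i
    peak⇒max a⋖i i⋖c πa<πi πc<πi q with <-cmp (toℕ q) (toℕ i)
    ... | tri< q<i _ _ = left-of-peak a⋖i πa<πi q q<i
    ... | tri≈ _ q≡i _ rewrite toℕ-injective q≡i = ≤-refl
    ... | tri> _ _ i<q = right-of-peak i⋖c πc<πi q i<q

max⇒val≡top : ∀ {m} (π : Permutation′ (suc m)) i → (∀ q → val π q ≤ val π i) → val π i ≡ m
max⇒val≡top {m} π i isMax =
  ≤-antisym (≤-pred (toℕ<n (π ⟨$⟩ʳ i))) (subst (_≤ val π i) val-top (isMax (π ⟨$⟩ˡ fromℕ m)))
  where
  val-top : val π (π ⟨$⟩ˡ fromℕ m) ≡ m
  val-top = trans (cong toℕ (inverseʳ π)) (toℕ-fromℕ m)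

lemma3p2 : (n : ℕ) → 3 ≤ n → (π : Permutation′ n) →
    Avoids213 π → Avoids312 π →
    (a i c : Fin n) → toℕ a + 1 ≡ toℕ i → toℕ i + 1 ≡ toℕ c →
    toℕ (sq π i) < toℕ (sq π a) → toℕ (sq π a) < toℕ (sq π c) →
    toℕ (π ⟨$⟩ʳ i) ≡ n ∸ 1
lemma3p2 (suc m) _ π h213 h312 a i c a+1≡i i+1≡c i<a² a<c² =
  let πa<πi , πc<πi = square213⇒peak π h213 h312 (≤-reflexive a⋖i) (≤-reflexive i⋖c) i<a² a<c²
  in max⇒val≡top π i (peak⇒max π (avoids213∧312⇒noValley π h213 h312) a⋖i i⋖c πa<πi πc<πi)
  where
  a⋖i : suc (toℕ a) ≡ toℕ i
  a⋖i = trans (+-comm 1 (toℕ a)) a+1≡i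
  i⋖c : suc (toℕ i) ≡ toℕ c
  i⋖c = trans (+-comm 1 (toℕ i)) i+1≡c
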